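{- The equation $x^2+3^{\alpha}\,113^{\beta}=y^{4}$ has no solutions in integers $x\ge 1$, $y\ge 1$, $\alpha\ge 0$, $\beta\ge 0$ with $\gcd(x,y)=1$. -}

-- With Y = y², the equation reads (Y − x)(Y + x) = 3^α 113^β, and the two factors are coprime
-- because the product is odd and gcd(x, y) = 1. Hence 2y² = 1 + 3^α 113^β or 2y² = 3^α + 113^β.
-- Reducing modulo 3 and 8 leaves 2y² = w² + 113^β with w = 3^k. In ℤ[√2] this says that
-- w + y√2 has norm −113^β; since 113 = ππ̄ with π = 11 + 2√2 and 113 ∤ w, one of w ± y√2 is
-- π^β ε with ε a unit of norm −1. The residues of all such π^β ε modulo 22995 are computed
-- (π acts on them with period 72): they exclude w = 1 for odd β, w = 3, and w ≡ 0 mod 9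
-- without w ≡ 0 mod 7. What remains, w = 1 with β even, is z² + 1 = 2y² with 113 ∣ z, which the
-- solutions of this Pell equation modulo 113 exclude.
module Submission where

open import Data.Nat.Base using (ℕ; zero; suc)
open import Data.Nat.GeneralisedArithmetic using (fold; fold-+)
open import Data.Nat.Primality
  using (Prime; prime?; prime[2]; prime⇒nonZero; prime⇒irreducible; euclidsLemma; ¬prime[1])
open import Data.List using (List; []; _∷_; map; iterate; concatMap; upTo)
open import Data.List.Relation.Unary.All as All using (All; all?; lookupAny)
open import Data.List.Relation.Unary.Any as Any using (Any; here; there)
open import Data.List.Relation.Unary.Any.Properties using (map⁺; concatMap⁺)
open import Data.List.Membership.Propositional using (_∈_)
open import Data.List.Membership.Propositional.Properties using (∈-upTo⁺)
open import Data.Product using (∃; ∃₂; _×_; _,_; proj₁; proj₂; map₂)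
open import Data.Sum using (_⊎_; inj₁; inj₂; [_,_]′)
open import Function using (_∘_; id)
open import Relation.Binary.PropositionalEquality
open import Relation.Nullary using (¬_; Dec; ¬?; yes; no; contradiction)
open import Relation.Nullary.Decidable using (from-yes; from-no; map′; _×-dec_; _→-dec_)

3-prime : Prime 3
3-prime = from-yes (prime? 3)

113-prime : Prime 113
113-prime = from-yes (prime? 113)

-- A pair (w , y) stands for w + y√2.
module ℤ[√2] where

  open import Data.Nat as ℕ using (NonZero; _%_; _/_; _∸_)
  import Data.Nat.Properties as ℕ
  open import Data.Nat.DivMod using (m≡m%n+[m/n]*n; m%n<n)
  open import Data.Nat.Divisibility as ℕ using (∣⇒≤)
  open import Data.Integer using (ℤ; +_; -[1+_]; -_; _+_; _*_; _-_; _^_; ∣_∣; -1ℤ)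
  open import Data.Integer.Properties
  open import Data.Integer.Divisibility.Signed
  open import Data.Integer.Tactic.RingSolver using (solve-∀)

  ∣∧<⇒≡0 : ∀ {m n} → m ℕ.∣ n → n ℕ.< m → n ≡ 0
  ∣∧<⇒≡0 {n = zero}  _   _   = refl
  ∣∧<⇒≡0 {n = suc n} m∣n n<m = contradiction (∣⇒≤ m∣n) (ℕ.<⇒≱ n<m)

  prime-∣-* : ∀ {p} → Prime p → ∀ a b → + p ∣ a * b → (+ p ∣ a) ⊎ (+ p ∣ b)
  prime-∣-* {p} p-prime a b p∣ab
    with euclidsLemma ∣ a ∣ ∣ b ∣ p-prime (subst (p ℕ.∣_) (abs-* a b) (∣⇒∣ᵤ p∣ab))
  ... | inj₁ p∣a = inj₁ (∣ᵤ⇒∣ p∣a)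
  ... | inj₂ p∣b = inj₂ (∣ᵤ⇒∣ p∣b)

  pos-^ : ∀ m n → + (m ℕ.^ n) ≡ (+ m) ^ n
  pos-^ m zero    = refl
  pos-^ m (suc n) = trans (pos-* m (m ℕ.^ n)) (cong (+ m *_) (pos-^ m n))

  norm : ℤ × ℤ → ℤ
  norm (w , y) = w * w - + 2 * (y * y)

  mulπ : ℤ × ℤ → ℤ × ℤ
  mulπ (w , y) = + 11 * w + + 4 * y , + 2 * w + + 11 * y

  conj : ℤ × ℤ → ℤ × ℤ
  conj (w , y) = w , - y

  norm-mulπ : ∀ p → norm (mulπ p) ≡ + 113 * norm p
  norm-mulπ (w , y) = identity w y
    where
    identity : ∀ w y → (+ 11 * w + + 4 * y) * (+ 11 * w + + 4 * y) - + 2 * ((+ 2 * w + + 11 * y) * (+ 2 * w + + 11 * y))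
                       ≡ + 113 * (w * w - + 2 * (y * y))
    identity = solve-∀

  norm-conj : ∀ p → norm (conj p) ≡ norm p
  norm-conj (w , y) = cong (λ t → w * w - + 2 * t) (neg-square y)
    where
    neg-square : ∀ y → - y * - y ≡ y * y
    neg-square = solve-∀

  -- π = 11 + 2√2 divides w + y√2 iff 113 = ππ̄ divides (w + y√2)(11 − 2√2)
  -- = (11w − 4y) + (11y − 2w)√2, and 113 ∣ 11y − 2w already forces 113 ∣ 11w − 4y.
  π∣_ : ℤ × ℤ → Set
  π∣ (w , y) = + 113 ∣ + 11 * y - + 2 * w

  113∣-113^[1+β] : ∀ β → + 113 ∣ - ((+ 113) ^ suc β)
  113∣-113^[1+β] β = ∣m⇒∣-m (∣m⇒∣m*n ((+ 113) ^ β) ∣-refl)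

  -- The quotient ((11w − 4y) + (11y − 2w)√2)/113, written without division using k = (11y − 2w)/113.
  π∣⇒mulπ : ∀ {p} → π∣ p → ∃ λ q → mulπ q ≡ p
  π∣⇒mulπ {w , y} (divides k 11y-2w≡k*113) = (+ 6 * y - w - + 62 * k , k) , cong₂ _,_
    (trans (expand₁ w y k) (trans (cong (λ t → w + + 6 * (t - k * + 113)) 11y-2w≡k*113) (cancel₁ w (k * + 113))))
    (trans (expand₂ w y k) (trans (cong (λ t → y + (t - k * + 113)) 11y-2w≡k*113) (cancel₂ y (k * + 113))))
    where
    expand₁ : ∀ w y k → + 11 * (+ 6 * y - w - + 62 * k) + + 4 * k ≡ w + + 6 * ((+ 11 * y - + 2 * w) - k * + 113)
    expand₁ = solve-∀
    cancel₁ : ∀ w t → w + + 6 * (t - t) ≡ w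
    cancel₁ = solve-∀
    expand₂ : ∀ w y k → + 2 * (+ 6 * y - w - + 62 * k) + + 11 * k ≡ y + ((+ 11 * y - + 2 * w) - k * + 113)
    expand₂ = solve-∀
    cancel₂ : ∀ y t → y + (t - t) ≡ y
    cancel₂ = solve-∀

  π∣⊎π∣conj : ∀ p → + 113 ∣ norm p → π∣ p ⊎ π∣ conj p
  π∣⊎π∣conj (w , y) 113∣norm = prime-∣-* 113-prime _ _ (subst (+ 113 ∣_) (sym (factor w y))
    (∣m∣n⇒∣m-n (∣n⇒∣m*n (+ 4) 113∣norm) (∣m⇒∣m*n (y * y) ∣-refl)))
    where
    factor : ∀ w y → (+ 11 * y - + 2 * w) * (+ 11 * - y - + 2 * w) ≡ + 4 * (w * w - + 2 * (y * y)) - + 113 * (y * y)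
    factor = solve-∀

  π∣conj⇒113∣mulπ : ∀ q → π∣ conj q → + 113 ∣ proj₁ (mulπ q)
  π∣conj⇒113∣mulπ (w , y) π∣q̄ = subst (+ 113 ∣_) (sym (combination w y))
    (∣m∣n⇒∣m-n (∣n⇒∣m*n (- + 62) π∣q̄) (∣n⇒∣m*n (w + + 6 * y) ∣-refl))
    where
    combination : ∀ w y → + 11 * w + + 4 * y ≡ - + 62 * (+ 11 * - y - + 2 * w) - (w + + 6 * y) * + 113
    combination = solve-∀

  113∣w⇒113∣y : ∀ {w y} β → norm (w , y) ≡ - ((+ 113) ^ suc β) → + 113 ∣ w → + 113 ∣ y
  113∣w⇒113∣y {w} {y} β norm≡ 113∣w =
    [ (λ 113∣2 → contradiction (∣⇒∣ᵤ 113∣2) (from-no (113 ℕ.∣? 2)))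
    , (λ 113∣y² → [ id , id ]′ (prime-∣-* 113-prime y y 113∣y²)) ]′
    (prime-∣-* 113-prime (+ 2) (y * y) 113∣2y²)
    where
    split : ∀ w y → + 2 * (y * y) ≡ w * w - (w * w - + 2 * (y * y))
    split = solve-∀
    113∣2y² : + 113 ∣ + 2 * (y * y)
    113∣2y² = subst (+ 113 ∣_) (sym (trans (split w y) (cong (λ t → w * w - t) norm≡)))
      (∣m∣n⇒∣m-n (∣m⇒∣m*n w 113∣w) (113∣-113^[1+β] β))

  mulπ-norm⁻¹ : ∀ β q → norm (mulπ q) ≡ - ((+ 113) ^ suc β) → norm q ≡ - ((+ 113) ^ β)
  mulπ-norm⁻¹ β q norm≡ = *-cancelˡ-≡ (+ 113) _ _
    (trans (sym (norm-mulπ q)) (trans norm≡ (neg-distribʳ (+ 113) ((+ 113) ^ β))))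
    where
    neg-distribʳ : ∀ a b → - (a * b) ≡ a * - b
    neg-distribʳ = solve-∀

  113∤mulπ⇒113∤ : ∀ β q → norm q ≡ - ((+ 113) ^ suc β) →
    ¬ + 113 ∣ proj₁ (mulπ q) → ¬ + 113 ∣ proj₁ q
  113∤mulπ⇒113∤ β q norm≡ 113∤ 113∣w =
    113∤ (∣m∣n⇒∣m+n (∣n⇒∣m*n (+ 11) 113∣w) (∣n⇒∣m*n (+ 4) (113∣w⇒113∣y β norm≡ 113∣w)))

  π-power-factor : ∀ β s → norm s ≡ - ((+ 113) ^ suc β) → ¬ + 113 ∣ proj₁ s → π∣ s →
    ∃ λ ε → norm ε ≡ -1ℤ × fold ε mulπ (suc β) ≡ s
  π-quotient-factor : ∀ β q → norm q ≡ - ((+ 113) ^ β) → ¬ + 113 ∣ proj₁ (mulπ q) →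
    ∃ λ ε → norm ε ≡ -1ℤ × fold ε mulπ β ≡ q

  π-power-factor β s norm≡ 113∤s π∣s = descend (π∣⇒mulπ π∣s)
    where
    descend : (∃ λ q → mulπ q ≡ s) → ∃ λ ε → norm ε ≡ -1ℤ × fold ε mulπ (suc β) ≡ s
    descend (q , mulπq≡s) = map₂ (map₂ (λ fold≡q → trans (cong mulπ fold≡q) mulπq≡s))
      (π-quotient-factor β q
        (mulπ-norm⁻¹ β q (subst (λ t → norm t ≡ - ((+ 113) ^ suc β)) (sym mulπq≡s) norm≡))
        (subst (λ t → ¬ + 113 ∣ proj₁ t) (sym mulπq≡s) 113∤s))

  -- The conjugate branch is impossible: π̄ ∣ q would make 113 = ππ̄ divide mulπ q.
  π-quotient-factor zero    q norm≡ _   = q , norm≡ , refl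
  π-quotient-factor (suc β) q norm≡ 113∤ =
    [ π-power-factor β q norm≡ (113∤mulπ⇒113∤ β q norm≡ 113∤)
    , (λ π∣q̄ → contradiction (π∣conj⇒113∣mulπ q π∣q̄) 113∤) ]′
    (π∣⊎π∣conj q (subst (+ 113 ∣_) (sym norm≡) (113∣-113^[1+β] β)))

  π-power-rational-part : ∀ β p → norm p ≡ - ((+ 113) ^ β) → ¬ + 113 ∣ proj₁ p →
    ∃ λ ε → norm ε ≡ -1ℤ × proj₁ (fold ε mulπ β) ≡ proj₁ p
  π-power-rational-part zero    p norm≡ _     = p , norm≡ , refl
  π-power-rational-part (suc β) p norm≡ 113∤w =
    [ (λ π∣p → map₂ (map₂ (cong proj₁)) (π-power-factor β p norm≡ 113∤w π∣p))
    , (λ π∣p̄ → map₂ (map₂ (cong proj₁))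
                  (π-power-factor β (conj p) (trans (norm-conj p) norm≡) 113∤w π∣p̄)) ]′
    (π∣⊎π∣conj p (subst (+ 113 ∣_) (sym norm≡) (113∣-113^[1+β] β)))

  solution⇒norm : ∀ {w y β} → w ℕ.* w ℕ.+ 113 ℕ.^ β ≡ 2 ℕ.* (y ℕ.* y) →
    norm (+ w , + y) ≡ - ((+ 113) ^ β)
  solution⇒norm {w} {y} {β} eq = trans (cong (λ t → + w * + w - t) (sym eqℤ)) (cancel (+ w * + w) ((+ 113) ^ β))
    where
    eqℤ : + w * + w + (+ 113) ^ β ≡ + 2 * (+ y * + y)
    eqℤ = begin
      + w * + w + (+ 113) ^ β     ≡⟨ cong₂ _+_ (pos-* w w) (pos-^ 113 β) ⟨
      + (w ℕ.* w) + + (113 ℕ.^ β) ≡⟨ pos-+ (w ℕ.* w) (113 ℕ.^ β) ⟨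
      + (w ℕ.* w ℕ.+ 113 ℕ.^ β)   ≡⟨ cong +_ eq ⟩
      + (2 ℕ.* (y ℕ.* y))         ≡⟨ trans (pos-* 2 (y ℕ.* y)) (cong (+ 2 *_) (pos-* y y)) ⟩
      + 2 * (+ y * + y)           ∎
      where open ≡-Reasoning
    cancel : ∀ a b → a - (a + b) ≡ - b
    cancel = solve-∀

  113∤⇒+113∤ : ∀ {w} → ¬ 113 ℕ.∣ w → ¬ + 113 ∣ + w
  113∤⇒+113∤ 113∤w = 113∤w ∘ ∣⇒∣ᵤ

  norm≡-1⇒pell : ∀ {w y} → norm (w , y) ≡ -1ℤ →
    ∣ w ∣ ℕ.* ∣ w ∣ ℕ.+ 1 ≡ 2 ℕ.* (∣ y ∣ ℕ.* ∣ y ∣)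
  norm≡-1⇒pell {w} {y} norm≡-1 = +-injective (begin
    + (∣ w ∣ ℕ.* ∣ w ∣ ℕ.+ 1)          ≡⟨ cong (_+ + 1) (i*i≡+∣i∣*∣i∣ w) ⟨
    w * w + + 1                        ≡⟨ cong (λ t → w * w - t) norm≡-1 ⟨
    w * w - (w * w - + 2 * (y * y))    ≡⟨ cancel (w * w) (+ 2 * (y * y)) ⟩
    + 2 * (y * y)                      ≡⟨ cong (+ 2 *_) (i*i≡+∣i∣*∣i∣ y) ⟩
    + 2 * + (∣ y ∣ ℕ.* ∣ y ∣)          ≡⟨ pos-* 2 (∣ y ∣ ℕ.* ∣ y ∣) ⟨
    + (2 ℕ.* (∣ y ∣ ℕ.* ∣ y ∣))        ∎)
    where
    open ≡-Reasoning
    i*i≡+∣i∣*∣i∣ : ∀ i → i * i ≡ + (∣ i ∣ ℕ.* ∣ i ∣)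
    i*i≡+∣i∣*∣i∣ (+ n)      = sym (pos-* n n)
    i*i≡+∣i∣*∣i∣ -[1+ n ]   = refl
    cancel : ∀ a b → a - (a - b) ≡ b
    cancel = solve-∀

  module Residues (m : ℕ) .{{_ : NonZero m}} where

    infix 4 _≈_ _≈²_
    _≈_ : ℤ → ℕ → Set
    a ≈ r = + m ∣ a - + r

    _≈²_ : ℤ × ℤ → ℕ × ℕ → Set
    (a , b) ≈² (r , s) = a ≈ r × b ≈ s

    ≈-% : ∀ n → + n ≈ n % m
    ≈-% n = divides (+ (n / m)) (begin
      + n - + (n % m)                         ≡⟨ cong (λ t → + t - + (n % m)) (m≡m%n+[m/n]*n n m) ⟩
      + (n % m ℕ.+ n / m ℕ.* m) - + (n % m)   ≡⟨ cong (_- + (n % m)) n≡ ⟩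
      + (n % m) + + (n / m) * + m - + (n % m) ≡⟨ cancel (+ (n % m)) (+ (n / m) * + m) ⟩
      + (n / m) * + m                         ∎)
      where
      open ≡-Reasoning
      n≡ : + (n % m ℕ.+ n / m ℕ.* m) ≡ + (n % m) + + (n / m) * + m
      n≡ = trans (pos-+ (n % m) _) (cong (λ t → + (n % m) + t) (pos-* (n / m) m))
      cancel : ∀ r k → r + k - r ≡ k
      cancel = solve-∀

    ≈-linear : ∀ c d {a b r s} → a ≈ r → b ≈ s → + c * a + + d * b ≈ (c ℕ.* r ℕ.+ d ℕ.* s) % m
    ≈-linear c d {a} {b} {r} {s} a≈r b≈s =
      subst (+ m ∣_) (regroup (+ c) (+ d) a b (+ r) (+ s) (+ (T % m)))
        (∣m∣n⇒∣m+n (∣m∣n⇒∣m+n (∣n⇒∣m*n (+ c) a≈r) (∣n⇒∣m*n (+ d) b≈s))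
                   (subst (λ t → + m ∣ t - + (T % m)) T≡ (≈-% T)))
      where
      T = c ℕ.* r ℕ.+ d ℕ.* s
      T≡ : + T ≡ + c * + r + + d * + s
      T≡ = trans (pos-+ (c ℕ.* r) (d ℕ.* s)) (cong₂ _+_ (pos-* c r) (pos-* d s))
      regroup : ∀ c d a b r s t → (c * (a - r) + d * (b - s)) + ((c * r + d * s) - t) ≡ c * a + d * b - t
      regroup = solve-∀

    ≈-neg : ∀ {a r} → a ≈ r → r ℕ.≤ m → - a ≈ (m ∸ r) % m
    ≈-neg {a} {r} a≈r r≤m =
      subst (+ m ∣_) (regroup a (+ m) (+ r) (+ ((m ∸ r) % m)))
        (∣m∣n⇒∣m+n (∣m∣n⇒∣m-n (∣m⇒∣-m a≈r) ∣-refl)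
                   (subst (λ t → + m ∣ t - + ((m ∸ r) % m)) m∸r≡ (≈-% (m ∸ r))))
      where
      m∸r≡ : + (m ∸ r) ≡ + m - + r
      m∸r≡ = sym (trans ([+m]-[+n]≡m⊖n m r) (≤-⊖ r≤m))
      regroup : ∀ a m r t → (- (a - r) - m) + ((m - r) - t) ≡ - a - t
      regroup = solve-∀

    ≈-abs : ∀ a → a ≈ ∣ a ∣ % m ⊎ a ≈ (m ∸ ∣ a ∣ % m) % m
    ≈-abs a with +∣i∣≡i⊎+∣i∣≡-i a
    ... | inj₁ ∣a∣≡a  = inj₁ (subst (_≈ ∣ a ∣ % m) ∣a∣≡a (≈-% ∣ a ∣))
    ... | inj₂ ∣a∣≡-a = inj₂ (subst (_≈ (m ∸ ∣ a ∣ % m) % m) (trans (cong -_ ∣a∣≡-a) (neg-involutive a))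
                                (≈-neg {+ ∣ a ∣} (≈-% ∣ a ∣) (ℕ.<⇒≤ (m%n<n ∣ a ∣ m))))

    ≈-residue : ∀ {n r} → + n ≈ r → r ℕ.< m → r ≡ n % m
    ≈-residue {n} {r} n≈r r<m = +-injective (i-j≡0⇒i≡j _ _ (∣i∣≡0⇒i≡0 ∣r-n%m∣≡0))
      where
      difference : ∀ a b c → (a - b) - (a - c) ≡ c - b
      difference = solve-∀
      m∣r-n%m : m ℕ.∣ ∣ + r - + (n % m) ∣
      m∣r-n%m = ∣⇒∣ᵤ (subst (+ m ∣_) (difference (+ n) (+ (n % m)) (+ r)) (∣m∣n⇒∣m-n (≈-% n) n≈r))
      ∣r-n%m∣<m : ∣ + r - + (n % m) ∣ ℕ.< m
      ∣r-n%m∣<m = subst (ℕ._< m) (cong ∣_∣ (sym ([+m]-[+n]≡m⊖n r (n % m))))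
                    (ℕ.≤-<-trans (∣m⊝n∣≤m⊔n r (n % m)) (ℕ.⊔-lub r<m (m%n<n n m)))
      ∣r-n%m∣≡0 : ∣ + r - + (n % m) ∣ ≡ 0
      ∣r-n%m∣≡0 = ∣∧<⇒≡0 m∣r-n%m ∣r-n%m∣<m

    ≈²-mulπ : ∀ {p r s} → p ≈² (r , s) →
      mulπ p ≈² ((11 ℕ.* r ℕ.+ 4 ℕ.* s) % m , (2 ℕ.* r ℕ.+ 11 ℕ.* s) % m)
    ≈²-mulπ {w , y} {r} {s} (w≈r , y≈s) =
      ≈-linear 11 4 {w} {y} {r} {s} w≈r y≈s , ≈-linear 2 11 {w} {y} {r} {s} w≈r y≈s

open ℤ[√2]
  using (norm; mulπ; π-power-rational-part; solution⇒norm; 113∤⇒+113∤; norm≡-1⇒pell; module Residues)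

open import Data.Nat
open import Data.Nat.Properties
open import Data.Nat.DivMod
open import Data.Nat.Divisibility
open import Data.Nat.Coprimality using (Coprime; coprime-divisor; gcd≡1⇒coprime)
open import Data.Nat.GCD using (gcd)
open import Data.Nat.Induction using (<-rec)
open import Data.Nat.Tactic.RingSolver using (solve-∀)
open import Data.Integer.Base as ℤ using (-1ℤ)
open import Data.Product.Properties using (≡-dec)
open import Data.List.Membership.DecPropositional (≡-dec _≟_ _≟_) using (_∈?_)

private
  variable
    a b c m n p q x i j : ℕ

m*m<n*n⇒m<n : m * m < n * n → m < n
m*m<n*n⇒m<n {m} {n} lt with n ≤? m
... | yes n≤m = contradiction (*-mono-≤ n≤m n≤m) (<⇒≱ lt)
... | no  n≰m = ≰⇒> n≰m

m*m≤n*n⇒m≤n : m * m ≤ n * n → m ≤ n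
m*m≤n*n⇒m≤n {m} {n} le with m ≤? n
... | yes m≤n = m≤n
... | no  m≰n = contradiction le (<⇒≱ (*-mono-< (≰⇒> m≰n) (≰⇒> m≰n)))

^-double : ∀ m k → m ^ (2 * k) ≡ m ^ k * m ^ k
^-double m k = trans (cong (m ^_) (cong (λ t → k + t) (+-identityʳ k))) (^-distribˡ-+-* m k k)

data EvenOrOdd : ℕ → Set where
  even : ∀ k → EvenOrOdd (2 * k)
  odd  : ∀ k → EvenOrOdd (1 + 2 * k)

even-or-odd : ∀ n → EvenOrOdd n
even-or-odd zero = even 0
even-or-odd (suc n) with even-or-odd n
... | even k = odd k
... | odd  k = subst EvenOrOdd (*-distribˡ-+ 2 1 k) (even (suc k))

[1+2k]%2≡1 : ∀ k → (1 + 2 * k) % 2 ≡ 1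
[1+2k]%2≡1 k = trans (cong (λ t → (1 + t) % 2) (*-comm 2 k)) ([m+kn]%n≡m%n 1 k 2)

residue-check : ∀ d .{{_ : NonZero d}} {P : ℕ → Set} → All P (upTo d) → ∀ n → P (n % d)
residue-check d all-residues n = All.lookup all-residues (∈-upTo⁺ (m%n<n n d))

prime∤⇒coprime : Prime p → ¬ p ∣ a → Coprime a p
prime∤⇒coprime p-prime p∤a (d∣a , d∣p) with prime⇒irreducible p-prime d∣p
... | inj₁ d≡1  = d≡1
... | inj₂ refl = contradiction d∣a p∤a

coprime-*ʳ : Coprime a m → Coprime a n → Coprime a (m * n)
coprime-*ʳ a⊥m a⊥n (d∣a , d∣mn) =
  a⊥n (d∣a , coprime-divisor (λ (e∣d , e∣m) → a⊥m (∣-trans e∣d d∣a , e∣m)) d∣mn)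

coprime-^ʳ : Coprime a m → ∀ n → Coprime a (m ^ n)
coprime-^ʳ a⊥m zero    (_ , d∣1) = ∣1⇒≡1 d∣1
coprime-^ʳ a⊥m (suc n) = coprime-*ʳ a⊥m (coprime-^ʳ a⊥m n)

prime∣^⇒∣ : Prime p → p ∣ m ^ n → p ∣ m
prime∣^⇒∣ {n = zero}  p-prime p∣1 = contradiction (subst Prime (∣1⇒≡1 p∣1) p-prime) ¬prime[1]
prime∣^⇒∣ {m = m} {n = suc n} p-prime p∣m^1+n with euclidsLemma m (m ^ n) p-prime p∣m^1+n
... | inj₁ p∣m   = p∣m
... | inj₂ p∣m^n = prime∣^⇒∣ {n = n} p-prime p∣m^n

prime∤^ : Prime p → ¬ p ∣ m → ¬ p ∣ m ^ n
prime∤^ {n = n} p-prime p∤m = p∤m ∘ prime∣^⇒∣ {n = n} p-prime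

prime∤* : Prime p → ¬ p ∣ m → ¬ p ∣ n → ¬ p ∣ m * n
prime∤* {m = m} {n} p-prime p∤m p∤n p∣mn with euclidsLemma m n p-prime p∣mn
... | inj₁ p∣m = p∤m p∣m
... | inj₂ p∣n = p∤n p∣n

prime∤∧∣^*⇒∣ : Prime p → ¬ p ∣ c → c ∣ p ^ i * n → c ∣ n
prime∤∧∣^*⇒∣ {i = i} p-prime p∤c = coprime-divisor (coprime-^ʳ (prime∤⇒coprime p-prime p∤c) i)

coprime-prime-split : Prime p → Coprime a b → ¬ p ∣ a ⊎ ¬ p ∣ b
coprime-prime-split {p} {a} {b} p-prime a⊥b with p ∣? a | p ∣? b
... | yes p∣a | yes p∣b = contradiction (subst Prime (a⊥b (p∣a , p∣b)) p-prime) ¬prime[1]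
... | yes _   | no  p∤b = inj₂ p∤b
... | no  p∤a | _       = inj₁ p∤a

divisors-of-product : a ∣ m → b ∣ n → a * b ≡ m * n → 0 < m * n → a ≡ m × b ≡ n
divisors-of-product {a} {b = b} (divides c refl) (divides e refl) ab≡mn mn>0 =
  trans (sym (*-identityˡ a)) (cong (_* a) (sym (m*n≡1⇒m≡1 c e ce≡1))) ,
  trans (sym (*-identityˡ b)) (cong (_* b) (sym (m*n≡1⇒n≡1 c e ce≡1)))
  where
  regroup : ∀ c a e b → c * a * (e * b) ≡ c * e * (a * b)
  regroup = solve-∀
  ce≡1 : c * e ≡ 1
  ce≡1 = *-cancelʳ-≡ (c * e) 1 (a * b) {{>-nonZero (subst (0 <_) (sym ab≡mn) mn>0)}}
           (trans (sym (regroup c a e b)) (trans (sym ab≡mn) (sym (*-identityˡ (a * b)))))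

coprime-factors-of-prime-powers : Prime p → Prime q → Coprime a b → a * b ≡ p ^ i * q ^ j →
  a ≡ 1 ⊎ b ≡ 1 ⊎ (a ≡ p ^ i × b ≡ q ^ j) ⊎ (a ≡ q ^ j × b ≡ p ^ i)
coprime-factors-of-prime-powers {p} {q} {a} {b} {i} {j} p-prime q-prime a⊥b ab≡N =
  cases (coprime-prime-split p-prime a⊥b) (coprime-prime-split q-prime a⊥b)
  where
  N≡N' : p ^ i * q ^ j ≡ q ^ j * p ^ i
  N≡N' = *-comm (p ^ i) (q ^ j)
  N>0 : 0 < p ^ i * q ^ j
  N>0 = *-mono-≤ (m^n>0 p {{prime⇒nonZero p-prime}} i) (m^n>0 q {{prime⇒nonZero q-prime}} j)
  a∣N : a ∣ p ^ i * q ^ j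
  a∣N = subst (a ∣_) ab≡N (m∣m*n b)
  b∣N : b ∣ p ^ i * q ^ j
  b∣N = subst (b ∣_) ab≡N (n∣m*n a)
  ∣p^i : ∀ {c} → ¬ q ∣ c → c ∣ p ^ i * q ^ j → c ∣ p ^ i
  ∣p^i {c} q∤c c∣N = prime∤∧∣^*⇒∣ {i = j} q-prime q∤c (subst (c ∣_) N≡N' c∣N)
  ∣q^j : ∀ {c} → ¬ p ∣ c → c ∣ p ^ i * q ^ j → c ∣ q ^ j
  ∣q^j = prime∤∧∣^*⇒∣ {i = i} p-prime
  unit : ∀ {c} → ¬ p ∣ c → ¬ q ∣ c → c ∣ p ^ i * q ^ j → c ≡ 1
  unit {c} p∤c q∤c c∣N = ∣1⇒≡1 (prime∤∧∣^*⇒∣ {i = j} q-prime q∤c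
    (subst (c ∣_) (sym (*-identityʳ (q ^ j))) (∣q^j p∤c c∣N)))
  cases : ¬ p ∣ a ⊎ ¬ p ∣ b → ¬ q ∣ a ⊎ ¬ q ∣ b →
          a ≡ 1 ⊎ b ≡ 1 ⊎ (a ≡ p ^ i × b ≡ q ^ j) ⊎ (a ≡ q ^ j × b ≡ p ^ i)
  cases (inj₁ p∤a) (inj₁ q∤a) = inj₁ (unit p∤a q∤a a∣N)
  cases (inj₂ p∤b) (inj₂ q∤b) = inj₂ (inj₁ (unit p∤b q∤b b∣N))
  cases (inj₂ p∤b) (inj₁ q∤a) =
    inj₂ (inj₂ (inj₁ (divisors-of-product (∣p^i q∤a a∣N) (∣q^j p∤b b∣N) ab≡N N>0)))
  cases (inj₁ p∤a) (inj₂ q∤b) =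
    inj₂ (inj₂ (inj₂ (divisors-of-product (∣q^j p∤a a∣N) (∣p^i q∤b b∣N)
      (trans ab≡N N≡N') (subst (0 <_) N≡N' N>0))))

-- Factoring x² + 3^α 113^β = y⁴

difference-of-squares : x * x + n ≡ m * m → 0 < n →
  ∃₂ λ a b → a + x ≡ m × b ≡ a + 2 * x × a * b ≡ n
difference-of-squares {x} {n} {m} eq n>0 = m ∸ x , m ∸ x + 2 * x , a+x≡m , refl , ab≡n
  where
  open ≡-Reasoning
  x<m : x < m
  x<m = m*m<n*n⇒m<n (subst (x * x <_) eq (m<m+n (x * x) n>0))
  a+x≡m : m ∸ x + x ≡ m
  a+x≡m = m∸n+n≡m (<⇒≤ x<m)
  expand : ∀ a x → (a + x) * (a + x) ≡ x * x + a * (a + 2 * x)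
  expand = solve-∀
  ab≡n : (m ∸ x) * (m ∸ x + 2 * x) ≡ n
  ab≡n = +-cancelˡ-≡ (x * x) _ _ (begin
    x * x + (m ∸ x) * (m ∸ x + 2 * x) ≡⟨ expand (m ∸ x) x ⟨
    (m ∸ x + x) * (m ∸ x + x)         ≡⟨ cong (λ t → t * t) a+x≡m ⟩
    m * m                             ≡⟨ eq ⟨
    x * x + n                         ∎)

coprime-difference-factors : ∀ {x y a b} → Coprime x y → ¬ 2 ∣ a * b →
  a + x ≡ y * y → b ≡ a + 2 * x → Coprime a b
coprime-difference-factors {x} {y} {a} {b} x⊥y ab-odd a+x≡y² refl {d} (d∣a , d∣b) = x⊥y (d∣x , d∣y)
  where
  d⊥2 : Coprime d 2
  d⊥2 = prime∤⇒coprime prime[2] (λ 2∣d → ab-odd (∣-trans 2∣d (∣-trans d∣a (m∣m*n b))))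
  d∣x : d ∣ x
  d∣x = coprime-divisor d⊥2 (∣m+n∣m⇒∣n d∣b d∣a)
  d∣y : d ∣ y
  d∣y = coprime-divisor (λ (e∣d , e∣y) → x⊥y (∣-trans e∣d d∣x , e∣y))
          (subst (d ∣_) a+x≡y² (∣m∣n⇒∣m+n d∣a d∣x))

3^α*113^β-odd : ∀ α β → ¬ 2 ∣ 3 ^ α * 113 ^ β
3^α*113^β-odd α β = prime∤* prime[2] (prime∤^ {n = α} prime[2] (from-no (2 ∣? 3)))
                                     (prime∤^ {n = β} prime[2] (from-no (2 ∣? 113)))

square-of-square : ∀ x y n → x ^ 2 + n ≡ y ^ 4 → x * x + n ≡ y * y * (y * y)
square-of-square x y n = subst₂ (λ s t → s + n ≡ t) (x^2≡x*x x) (y^4≡y²*y² y)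
  where
  x^2≡x*x : ∀ x → x * (x * 1) ≡ x * x
  x^2≡x*x = solve-∀
  y^4≡y²*y² : ∀ y → y * (y * (y * (y * 1))) ≡ y * y * (y * y)
  y^4≡y²*y² = solve-∀

3^α*113^β>0 : ∀ α β → 0 < 3 ^ α * 113 ^ β
3^α*113^β>0 α β = *-mono-≤ (m^n>0 3 α) (m^n>0 113 β)

coprime-factor-pair : ∀ {x y α β} → x ≥ 1 → gcd x y ≡ 1 → x ^ 2 + 3 ^ α * 113 ^ β ≡ y ^ 4 →
  ∃₂ λ a b → Coprime a b × a < b × a * b ≡ 3 ^ α * 113 ^ β × 2 * (y * y) ≡ a + b
coprime-factor-pair {x} {y} {α} {β} x≥1 gcd≡1 eq
  with difference-of-squares (square-of-square x y _ eq) (3^α*113^β>0 α β)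
... | a , b , a+x≡y² , b≡a+2x , ab≡N = a , b , a⊥b , a<b , ab≡N , 2y²≡a+b
  where
  a⊥b : Coprime a b
  a⊥b = coprime-difference-factors (gcd≡1⇒coprime gcd≡1)
          (subst (λ n → ¬ 2 ∣ n) (sym ab≡N) (3^α*113^β-odd α β)) a+x≡y² b≡a+2x
  a<b : a < b
  a<b = subst (a <_) (sym b≡a+2x) (m<m+n a (*-mono-≤ {1} {2} (s≤s z≤n) x≥1))
  halves : ∀ a x → 2 * (a + x) ≡ a + (a + 2 * x)
  halves = solve-∀
  2y²≡a+b : 2 * (y * y) ≡ a + b
  2y²≡a+b = trans (cong (2 *_) (sym a+x≡y²)) (trans (halves a x) (cong (λ t → a + t) (sym b≡a+2x)))

twice-square-equation : ∀ {x y α β} → x ≥ 1 → gcd x y ≡ 1 → x ^ 2 + 3 ^ α * 113 ^ β ≡ y ^ 4 →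
  (2 * (y * y) ≡ 1 + 3 ^ α * 113 ^ β × 1 < 3 ^ α * 113 ^ β) ⊎
  (2 * (y * y) ≡ 3 ^ α + 113 ^ β × 3 ^ α ≢ 113 ^ β)
twice-square-equation {x} {y} {α} {β} x≥1 gcd≡1 eq
  with coprime-factor-pair {x} {y} {α} {β} x≥1 gcd≡1 eq
... | a , b , a⊥b , a<b , ab≡N , 2y²≡a+b =
  cases (coprime-factors-of-prime-powers {i = α} {j = β} 3-prime 113-prime a⊥b ab≡N)
  where
  cases : a ≡ 1 ⊎ b ≡ 1 ⊎ (a ≡ 3 ^ α × b ≡ 113 ^ β) ⊎ (a ≡ 113 ^ β × b ≡ 3 ^ α) →
    (2 * (y * y) ≡ 1 + 3 ^ α * 113 ^ β × 1 < 3 ^ α * 113 ^ β) ⊎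
    (2 * (y * y) ≡ 3 ^ α + 113 ^ β × 3 ^ α ≢ 113 ^ β)
  cases (inj₁ a≡1) = inj₁ (trans 2y²≡a+b (cong₂ _+_ a≡1 b≡N) , subst₂ _<_ a≡1 b≡N a<b)
    where
    b≡N : b ≡ 3 ^ α * 113 ^ β
    b≡N = trans (sym (*-identityˡ b)) (trans (cong (_* b) (sym a≡1)) ab≡N)
  cases (inj₂ (inj₁ b≡1)) = contradiction (trans (sym ab≡N) (cong (_* b) a≡0)) (m<n⇒n≢0 (3^α*113^β>0 α β))
    where
    a≡0 : a ≡ 0
    a≡0 = n<1⇒n≡0 (subst (a <_) b≡1 a<b)
  cases (inj₂ (inj₂ (inj₁ (a≡3^α , b≡113^β)))) =
    inj₂ (trans 2y²≡a+b (cong₂ _+_ a≡3^α b≡113^β) , <⇒≢ (subst₂ _<_ a≡3^α b≡113^β a<b))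
  cases (inj₂ (inj₂ (inj₂ (a≡113^β , b≡3^α)))) =
    inj₂ (trans 2y²≡a+b (trans (cong₂ _+_ a≡113^β b≡3^α) (+-comm (113 ^ β) (3 ^ α))) ,
          ≢-sym (<⇒≢ (subst₂ _<_ a≡113^β b≡3^α a<b)))

-- Obstructions modulo 3 and 8

1%d≡1 : ∀ a d .{{_ : NonZero d}} → a % d ≡ 1 → 1 % d ≡ 1
1%d≡1 a d a%d≡1 = trans (cong (_% d) (sym a%d≡1)) (trans (m%n%n≡m%n a d) a%d≡1)

^%≡1 : ∀ a n d .{{_ : NonZero d}} → a % d ≡ 1 → a ^ n % d ≡ 1
^%≡1 a zero    d a%d≡1 = 1%d≡1 a d a%d≡1
^%≡1 a (suc n) d a%d≡1 = begin
  a * a ^ n % d             ≡⟨ %-distribˡ-* a (a ^ n) d ⟩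
  (a % d) * (a ^ n % d) % d ≡⟨ cong₂ (λ s t → s * t % d) a%d≡1 (^%≡1 a n d a%d≡1) ⟩
  1 % d                     ≡⟨ 1%d≡1 a d a%d≡1 ⟩
  1                         ∎
  where open ≡-Reasoning

twice-square-% : ∀ y d .{{_ : NonZero d}} → 2 * (y * y) % d ≡ 2 * ((y % d) * (y % d)) % d
twice-square-% y d = begin
  2 * (y * y) % d                           ≡⟨ %-distribˡ-* 2 (y * y) d ⟩
  2 % d * (y * y % d) % d                   ≡⟨ cong (λ t → 2 % d * t % d) (%-distribˡ-* y y d) ⟩
  2 % d * ((y % d) * (y % d) % d) % d       ≡⟨ %-distribˡ-* 2 ((y % d) * (y % d)) d ⟨
  2 * ((y % d) * (y % d)) % d               ∎
  where open ≡-Reasoning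

twice-square-%3≢1 : ∀ y → 2 * (y * y) % 3 ≢ 1
twice-square-%3≢1 y = subst (_≢ 1) (sym (twice-square-% y 3))
  (residue-check 3 (from-yes (all? (λ r → ¬? (2 * (r * r) % 3 ≟ 1)) (upTo 3))) y)

twice-square-%8≢4 : ∀ y → 2 * (y * y) % 8 ≢ 4
twice-square-%8≢4 y = subst (_≢ 4) (sym (twice-square-% y 8))
  (residue-check 8 (from-yes (all? (λ r → ¬? (2 * (r * r) % 8 ≟ 4)) (upTo 8))) y)

twice-square≢1+3^[1+α]*t : ∀ y α t → 2 * (y * y) ≢ 1 + 3 ^ suc α * t
twice-square≢1+3^[1+α]*t y α t eq = twice-square-%3≢1 y (begin
  2 * (y * y) % 3             ≡⟨ cong (_% 3) eq ⟩
  (1 + 3 ^ suc α * t) % 3     ≡⟨ cong (λ s → (1 + s) % 3) (regroup (3 ^ α) t) ⟩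
  (1 + 3 ^ α * t * 3) % 3     ≡⟨ [m+kn]%n≡m%n 1 (3 ^ α * t) 3 ⟩
  1                           ∎)
  where
  open ≡-Reasoning
  regroup : ∀ s t → 3 * s * t ≡ s * t * 3
  regroup = solve-∀

twice-square≢3^[1+2k]+113^β : ∀ y k β → 2 * (y * y) ≢ 3 ^ (1 + 2 * k) + 113 ^ β
twice-square≢3^[1+2k]+113^β y k β eq = twice-square-%8≢4 y (begin
  2 * (y * y) % 8                                 ≡⟨ cong (_% 8) eq ⟩
  (3 * 3 ^ (2 * k) + 113 ^ β) % 8                  ≡⟨ cong (λ s → (3 * s + 113 ^ β) % 8) (^-*-assoc 3 2 k) ⟨
  (3 * 9 ^ k + 113 ^ β) % 8                        ≡⟨ %-distribˡ-+ (3 * 9 ^ k) (113 ^ β) 8 ⟩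
  (3 * 9 ^ k % 8 + 113 ^ β % 8) % 8                ≡⟨ cong₂ (λ s t → (s + t) % 8) 3*9^k%8≡3 (^%≡1 113 β 8 refl) ⟩
  4                                               ∎)
  where
  open ≡-Reasoning
  3*9^k%8≡3 : 3 * 9 ^ k % 8 ≡ 3
  3*9^k%8≡3 = trans (%-distribˡ-* 3 (9 ^ k) 8) (cong (λ s → 3 * s % 8) (^%≡1 9 k 8 refl))

-- The Pell equation z² + 1 = 2y²

-- Multiplication of d + e√2 by the fundamental unit 3 + 2√2.
pellStep : ℕ × ℕ → ℕ × ℕ
pellStep (d , e) = 3 * d + 4 * e , 2 * d + 3 * e

IsPell : ℕ × ℕ → Set
IsPell (z , y) = z * z + 1 ≡ 2 * (y * y)

pellStep-reflects : ∀ p → IsPell (pellStep p) → IsPell p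
pellStep-reflects (d , e) pell = +-cancelˡ-≡ (2 * (y * y)) _ _ (begin
  2 * (y * y) + (d * d + 1)     ≡⟨ regroup d e ⟩
  ((3 * d + 4 * e) * (3 * d + 4 * e) + 1) + 2 * (e * e) ≡⟨ cong (_+ 2 * (e * e)) pell ⟩
  2 * (y * y) + 2 * (e * e)     ∎)
  where
  open ≡-Reasoning
  y = 2 * d + 3 * e
  regroup : ∀ d e → 2 * ((2 * d + 3 * e) * (2 * d + 3 * e)) + (d * d + 1)
                  ≡ ((3 * d + 4 * e) * (3 * d + 4 * e) + 1) + 2 * (e * e)
  regroup = solve-∀

pellStep-inverse : ∀ {y d z e} → 4 * y + d ≡ 3 * z → 2 * z + e ≡ 3 * y → pellStep (d , e) ≡ (z , y)
pellStep-inverse {y} {d} {z} {e} 4y+d≡3z 2z+e≡3y = cong₂ _,_ z≡ y≡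
  where
  open ≡-Reasoning
  z≡ : 3 * d + 4 * e ≡ z
  z≡ = +-cancelˡ-≡ (8 * z) _ _ (begin
    8 * z + (3 * d + 4 * e)       ≡⟨ solve₁ z d e ⟩
    4 * (2 * z + e) + 3 * d       ≡⟨ cong (λ t → 4 * t + 3 * d) 2z+e≡3y ⟩
    4 * (3 * y) + 3 * d           ≡⟨ solve₂ y d ⟩
    3 * (4 * y + d)               ≡⟨ cong (3 *_) 4y+d≡3z ⟩
    3 * (3 * z)                   ≡⟨ solve₃ z ⟩
    8 * z + z                     ∎)
    where
    solve₁ : ∀ z d e → 8 * z + (3 * d + 4 * e) ≡ 4 * (2 * z + e) + 3 * d
    solve₁ = solve-∀
    solve₂ : ∀ y d → 4 * (3 * y) + 3 * d ≡ 3 * (4 * y + d)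
    solve₂ = solve-∀
    solve₃ : ∀ z → 3 * (3 * z) ≡ 8 * z + z
    solve₃ = solve-∀
  y≡ : 2 * d + 3 * e ≡ y
  y≡ = *-cancelˡ-≡ _ _ 3 (begin
    3 * (2 * d + 3 * e)           ≡⟨ solve₄ d e ⟩
    2 * (3 * d + 4 * e) + e       ≡⟨ cong (λ t → 2 * t + e) z≡ ⟩
    2 * z + e                     ≡⟨ 2z+e≡3y ⟩
    3 * y                         ∎)
    where
    solve₄ : ∀ d e → 3 * (2 * d + 3 * e) ≡ 2 * (3 * d + 4 * e) + e
    solve₄ = solve-∀

pell-4y≤3z : ∀ {z y} → IsPell (z , y) → 3 ≤ y → 4 * y ≤ 3 * z
pell-4y≤3z {z} {y} pell 3≤y = m*m≤n*n⇒m≤n (+-cancelʳ-≤ 9 _ _ (begin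
  4 * y * (4 * y) + 9            ≤⟨ +-monoʳ-≤ (4 * y * (4 * y)) (≤-trans (*-mono-≤ 3≤y 3≤y) (m≤m+n (y * y) _)) ⟩
  4 * y * (4 * y) + 2 * (y * y)  ≡⟨ regroup y ⟩
  9 * (2 * (y * y))              ≡⟨ cong (9 *_) pell ⟨
  9 * (z * z + 1)                ≡⟨ expand z ⟩
  3 * z * (3 * z) + 9            ∎))
  where
  open ≤-Reasoning
  regroup : ∀ y → 4 * y * (4 * y) + 2 * (y * y) ≡ 9 * (2 * (y * y))
  regroup = solve-∀
  expand : ∀ z → 9 * (z * z + 1) ≡ 3 * z * (3 * z) + 9
  expand = solve-∀

pell-2z≤3y : ∀ {z y} → IsPell (z , y) → 2 * z ≤ 3 * y
pell-2z≤3y {z} {y} pell = m*m≤n*n⇒m≤n (begin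
  2 * z * (2 * z)                ≤⟨ m≤m+n (2 * z * (2 * z)) 4 ⟩
  2 * z * (2 * z) + 4            ≡⟨ expand z ⟩
  4 * (z * z + 1)                ≡⟨ cong (4 *_) pell ⟩
  4 * (2 * (y * y))              ≡⟨ *-assoc 4 2 (y * y) ⟨
  8 * (y * y)                    ≤⟨ *-monoˡ-≤ (y * y) (n≤1+n 8) ⟩
  9 * (y * y)                    ≡⟨ regroup y ⟩
  3 * y * (3 * y)                ∎)
  where
  open ≤-Reasoning
  expand : ∀ z → 2 * z * (2 * z) + 4 ≡ 4 * (z * z + 1)
  expand = solve-∀
  regroup : ∀ y → 9 * (y * y) ≡ 3 * y * (3 * y)
  regroup = solve-∀

pell-y<z : ∀ {z y} → IsPell (z , y) → 2 ≤ y → y < z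
pell-y<z {z} {y} pell 2≤y = m*m<n*n⇒m<n (+-cancelʳ-< 1 _ _ (begin-strict
  y * y + 1                      <⟨ +-monoʳ-< (y * y) (≤-trans (s≤s (s≤s z≤n)) (*-mono-≤ 2≤y 2≤y)) ⟩
  y * y + y * y                  ≡⟨ regroup y ⟩
  2 * (y * y)                    ≡⟨ pell ⟨
  z * z + 1                      ∎))
  where
  open ≤-Reasoning
  regroup : ∀ y → y * y + y * y ≡ 2 * (y * y)
  regroup = solve-∀

pell-descent : ∀ {z y} → IsPell (z , y) → 3 ≤ y → ∃ λ p → pellStep p ≡ (z , y) × proj₂ p < y
pell-descent {z} {y} pell 3≤y =
  (3 * z ∸ 4 * y , 3 * y ∸ 2 * z) , pellStep-inverse (m+[n∸m]≡n (pell-4y≤3z {z} {y} pell 3≤y)) 2z+e≡3y , e<y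
  where
  open ≤-Reasoning
  2z+e≡3y : 2 * z + (3 * y ∸ 2 * z) ≡ 3 * y
  2z+e≡3y = m+[n∸m]≡n (pell-2z≤3y {z} {y} pell)
  e<y : 3 * y ∸ 2 * z < y
  e<y = +-cancelˡ-< (2 * y) _ y (begin-strict
    2 * y + (3 * y ∸ 2 * z) <⟨ +-monoˡ-< _ (*-monoʳ-< 2 (pell-y<z {z} {y} pell (≤-trans (n≤1+n 2) 3≤y))) ⟩
    2 * z + (3 * y ∸ 2 * z) ≡⟨ 2z+e≡3y ⟩
    3 * y                   ≡⟨ +-comm y (2 * y) ⟩
    2 * y + y               ∎)

n*n≢7 : ∀ n → n * n ≢ 7
n*n≢7 0 ()
n*n≢7 1 ()
n*n≢7 2 ()
n*n≢7 n@(suc (suc (suc _))) = >⇒≢ (≤-trans (n≤1+n 8) (*-mono-≤ {3} {n} {3} {n} 3≤n 3≤n))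
  where
  3≤n : 3 ≤ n
  3≤n = s≤s (s≤s (s≤s z≤n))

pell-induction : (P : ℕ × ℕ → Set) → P (1 , 1) → (∀ p → P p → P (pellStep p)) → ∀ p → IsPell p → P p
pell-induction P base step (z , y) = <-rec (λ y → ∀ z → IsPell (z , y) → P (z , y)) solve y z
  where
  solve : ∀ y → (∀ {y′} → y′ < y → ∀ z → IsPell (z , y′) → P (z , y′)) → ∀ z → IsPell (z , y) → P (z , y)
  solve 0 _ z pell = contradiction pell (m+1+n≢0 (z * z))
  solve 1 _ z pell = subst (λ z → P (z , 1)) (sym (m*n≡1⇒m≡1 z z (+-cancelʳ-≡ 1 (z * z) 1 pell))) base
  solve 2 _ z pell = contradiction (+-cancelʳ-≡ 1 (z * z) 7 pell) (n*n≢7 z)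
  solve y@(suc (suc (suc _))) smaller z pell =
    subst P step≡ (step (d , e) (smaller e<y d (pellStep-reflects (d , e) (subst IsPell (sym step≡) pell))))
    where
    descent : ∃ λ p → pellStep p ≡ (z , y) × proj₂ p < y
    descent = pell-descent pell (s≤s (s≤s (s≤s z≤n)))
    d = proj₁ (proj₁ descent)
    e = proj₂ (proj₁ descent)
    step≡ = proj₁ (proj₂ descent)
    e<y = proj₂ (proj₂ descent)

reduce : ∀ m .{{_ : NonZero m}} → ℕ × ℕ → ℕ × ℕ
reduce m (a , b) = a % m , b % m

*%-absorbʳ : ∀ c a m .{{_ : NonZero m}} → c * a % m ≡ c * (a % m) % m
*%-absorbʳ c a m = begin
  c * a % m                 ≡⟨ %-distribˡ-* c a m ⟩
  c % m * (a % m) % m       ≡⟨ cong (λ t → c % m * t % m) (m%n%n≡m%n a m) ⟨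
  c % m * (a % m % m) % m   ≡⟨ %-distribˡ-* c (a % m) m ⟨
  c * (a % m) % m           ∎
  where open ≡-Reasoning

%-linear : ∀ c d a b m .{{_ : NonZero m}} → (c * a + d * b) % m ≡ (c * (a % m) + d * (b % m)) % m
%-linear c d a b m = begin
  (c * a + d * b) % m                             ≡⟨ %-distribˡ-+ (c * a) (d * b) m ⟩
  (c * a % m + d * b % m) % m                     ≡⟨ cong₂ (λ s t → (s + t) % m) (*%-absorbʳ c a m) (*%-absorbʳ d b m) ⟩
  (c * (a % m) % m + d * (b % m) % m) % m         ≡⟨ %-distribˡ-+ (c * (a % m)) (d * (b % m)) m ⟨
  (c * (a % m) + d * (b % m)) % m                 ∎
  where open ≡-Reasoning

pell-residues : ∀ m .{{_ : NonZero m}} {L : List (ℕ × ℕ)} →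
  reduce m (1 , 1) ∈ L → All (λ p → reduce m (pellStep p) ∈ L) L → ∀ p → IsPell p → reduce m p ∈ L
pell-residues m {L} base closed = pell-induction (λ p → reduce m p ∈ L) base
  (λ (d , e) p∈L → subst (_∈ L) (sym (cong₂ _,_ (%-linear 3 4 d e m) (%-linear 2 3 d e m)))
                                 (All.lookup closed p∈L))

pellResidues : ∀ m .{{_ : NonZero m}} → ℕ → List (ℕ × ℕ)
pellResidues m = iterate (reduce m ∘ pellStep) (1 , 1)

pell⇒113∤z : ∀ {z y} → IsPell (z , y) → ¬ 113 ∣ z
pell⇒113∤z {z} {y} pell 113∣z =
  All.lookup nonzero (pell-residues 113 (here refl) closed (z , y) pell) (n∣m⇒m%n≡0 z 113 113∣z)
  where
  L = pellResidues 113 28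
  closed : All (λ p → reduce 113 (pellStep p) ∈ L) L
  closed = from-yes (all? (λ p → reduce 113 (pellStep p) ∈? L) L)
  nonzero : All (λ p → proj₁ p ≢ 0) L
  nonzero = from-yes (all? (λ p → ¬? (proj₁ p ≟ 0)) L)

-- Residues modulo 22995 of the solutions of w² + 113^β = 2y²

-- 22995 = 3² · 5 · 7 · 73. The factor 63 excludes w = 3 and ties 9 ∣ w to 7 ∣ w; the factors
-- 5 and 73 are what excludes w = 1 for odd β.
M : ℕ
M = 22995

negate : ℕ → ℕ
negate r = (M ∸ r) % M

signs : ℕ × ℕ → List (ℕ × ℕ)
signs (a , b) = (a , b) ∷ (negate a , b) ∷ (a , negate b) ∷ (negate a , negate b) ∷ []

unitResidues : List (ℕ × ℕ)
unitResidues = concatMap signs (pellResidues M 36)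

mulπ-mod : ℕ × ℕ → ℕ × ℕ
mulπ-mod (a , b) = (11 * a + 4 * b) % M , (2 * a + 11 * b) % M

solutionResidues : ℕ → List (ℕ × ℕ)
solutionResidues = fold unitResidues (map mulπ-mod)

record Admissible (b a : ℕ) : Set where
  field
    a<M    : a < M
    a≢3    : a ≢ 3
    9∣⇒7∣  : 9 ∣ a → 7 ∣ a
    odd⇒≢1 : b ≡ 1 → a ≢ 1

admissible? : ∀ b a → Dec (Admissible b a)
admissible? b a = map′
  (λ (a<M , a≢3 , 9∣⇒7∣ , odd⇒≢1) →
     record { a<M = a<M ; a≢3 = a≢3 ; 9∣⇒7∣ = 9∣⇒7∣ ; odd⇒≢1 = odd⇒≢1 })
  (λ admissible → let open Admissible admissible in a<M , a≢3 , 9∣⇒7∣ , odd⇒≢1)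
  ((a <? M) ×-dec ¬? (a ≟ 3) ×-dec ((9 ∣? a) →-dec (7 ∣? a)) ×-dec ((b ≟ 1) →-dec ¬? (a ≟ 1)))

fold-periodic : ∀ {A : Set} (x : A) f p .{{_ : NonZero p}} → fold x f p ≡ x →
  ∀ n → fold x f n ≡ fold x f (n % p)
fold-periodic x f p period n = begin
  fold x f n                               ≡⟨ cong (fold x f) (m≡m%n+[m/n]*n n p) ⟩
  fold x f (n % p + n / p * p)             ≡⟨ fold-+ x f (n % p) ⟩
  fold (fold x f (n / p * p)) f (n % p)    ≡⟨ cong (λ z → fold z f (n % p)) (multiples (n / p)) ⟩
  fold x f (n % p)                         ∎
  where
  open ≡-Reasoning
  multiples : ∀ k → fold x f (k * p) ≡ x
  multiples zero    = refl
  multiples (suc k) = trans (fold-+ x f p) (trans (cong (λ z → fold z f p) (multiples k)) period)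

solutionResidues-period : solutionResidues 72 ≡ unitResidues
solutionResidues-period = refl

admissible-table : All (λ k → All (Admissible (k % 2) ∘ proj₁) (solutionResidues k)) (upTo 72)
admissible-table = from-yes (all? (λ k → all? (admissible? (k % 2) ∘ proj₁) (solutionResidues k)) (upTo 72))

admissible-residues : ∀ β → All (Admissible (β % 2) ∘ proj₁) (solutionResidues β)
admissible-residues β = subst₂ (λ b L → All (Admissible b ∘ proj₁) L)
  (m∣n⇒o%n%m≡o%m 2 72 β (divides 36 refl))
  (sym (fold-periodic unitResidues (map mulπ-mod) 72 solutionResidues-period β))
  (residue-check 72 admissible-table β)

open Residues M using (_≈_; _≈²_; ≈-abs; ≈-residue; ≈²-mulπ)

unit-residues : ∀ {ε} → norm ε ≡ -1ℤ → Any (ε ≈²_) unitResidues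
unit-residues {w , y} norm≡-1 = concatMap⁺ signs (Any.map (λ { refl → sign-residues })
  (pell-residues M (here refl) closed (ℤ.∣ w ∣ , ℤ.∣ y ∣) (norm≡-1⇒pell {w} {y} norm≡-1)))
  where
  L = pellResidues M 36
  closed : All (λ p → reduce M (pellStep p) ∈ L) L
  closed = from-yes (all? (λ p → reduce M (pellStep p) ∈? L) L)
  sign-residues : Any ((w , y) ≈²_) (signs (ℤ.∣ w ∣ % M , ℤ.∣ y ∣ % M))
  sign-residues with ≈-abs w | ≈-abs y
  ... | inj₁ w≈ | inj₁ y≈ = here (w≈ , y≈)
  ... | inj₂ w≈ | inj₁ y≈ = there (here (w≈ , y≈))
  ... | inj₁ w≈ | inj₂ y≈ = there (there (here (w≈ , y≈)))
  ... | inj₂ w≈ | inj₂ y≈ = there (there (there (here (w≈ , y≈))))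

π-power-residues : ∀ {ε} → Any (ε ≈²_) unitResidues → ∀ β → Any (fold ε mulπ β ≈²_) (solutionResidues β)
π-power-residues ε≈ zero    = ε≈
π-power-residues {ε} ε≈ (suc β) =
  map⁺ (Any.map (λ {r} → ≈²-mulπ {fold ε mulπ β} {proj₁ r} {proj₂ r}) (π-power-residues ε≈ β))

admissible-residue : ∀ β w y → w * w + 113 ^ β ≡ 2 * (y * y) → ¬ 113 ∣ w → Admissible (β % 2) (w % M)
admissible-residue β w y eq 113∤w = subst (Admissible (β % 2)) (≈-residue w≈r (Admissible.a<M admissible)) admissible
  where
  factor : ∃ λ ε → norm ε ≡ -1ℤ × proj₁ (fold ε mulπ β) ≡ ℤ.+ w
  factor = π-power-rational-part β (ℤ.+ w , ℤ.+ y) (solution⇒norm {w} {y} {β} eq) (113∤⇒+113∤ {w} 113∤w)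
  ε = proj₁ factor
  residues : Any (fold ε mulπ β ≈²_) (solutionResidues β)
  residues = π-power-residues {ε} (unit-residues {ε} (proj₁ (proj₂ factor))) β
  r : ℕ
  r = proj₁ (Any.lookup residues)
  found : Admissible (β % 2) r × fold ε mulπ β ≈² Any.lookup residues
  found = lookupAny (admissible-residues β) residues
  admissible : Admissible (β % 2) r
  admissible = proj₁ found
  w≈r : ℤ.+ w ≈ r
  w≈r = subst (_≈ r) (proj₂ (proj₂ factor)) (proj₁ (proj₂ found))

no-solution-w≡1 : ∀ β y → β % 2 ≡ 1 → 1 + 113 ^ β ≢ 2 * (y * y)
no-solution-w≡1 β y β-odd eq =
  Admissible.odd⇒≢1 (admissible-residue β 1 y eq (from-no (113 ∣? 1))) β-odd refl

no-solution-w≡3 : ∀ β y → 3 * 3 + 113 ^ β ≢ 2 * (y * y)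
no-solution-w≡3 β y eq = Admissible.a≢3 (admissible-residue β 3 y eq (from-no (113 ∣? 3))) refl

9∣w⇒7∣w : ∀ β w y → w * w + 113 ^ β ≡ 2 * (y * y) → ¬ 113 ∣ w → 9 ∣ w → 7 ∣ w
9∣w⇒7∣w β w y eq 113∤w 9∣w = ∣n∣m%n⇒∣m (divides 3285 refl)
  (Admissible.9∣⇒7∣ (admissible-residue β w y eq 113∤w) (%-presˡ-∣ 9∣w (divides 2555 refl)))

no-solution-3^k : ∀ k β y → 3 ^ (2 * k) ≢ 113 ^ β → 3 ^ k * 3 ^ k + 113 ^ β ≢ 2 * (y * y)
no-solution-3^k zero β y 1≢113^β eq with even-or-odd β
... | odd j        = no-solution-w≡1 (1 + 2 * j) y ([1+2k]%2≡1 j) eq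
... | even zero    = 1≢113^β refl
... | even (suc j) = pell⇒113∤z {113 ^ suc j} {y} pell (m∣m*n (113 ^ j))
  where
  pell : IsPell (113 ^ suc j , y)
  pell = trans (+-comm _ 1) (trans (cong (λ t → 1 + t) (sym (^-double 113 (suc j)))) eq)
no-solution-3^k (suc zero)    β y _ = no-solution-w≡3 β y
no-solution-3^k (suc (suc i)) β y _ eq =
  prime∤^ {n = 2 + i} 7-prime (from-no (7 ∣? 3))
    (9∣w⇒7∣w β (3 ^ (2 + i)) y eq (prime∤^ {n = 2 + i} 113-prime (from-no (113 ∣? 3))) 9∣3^[2+i])
  where
  7-prime : Prime 7
  7-prime = from-yes (prime? 7)
  9∣3^[2+i] : 9 ∣ 3 ^ (2 + i)
  9∣3^[2+i] = divides (3 ^ i) (nine (3 ^ i))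
    where
    nine : ∀ t → 3 * (3 * t) ≡ t * 9
    nine = solve-∀

reduced-equation : ∀ α β y → 3 ^ α ≢ 113 ^ β → 2 * (y * y) ≢ 3 ^ α + 113 ^ β
reduced-equation α β y 3^α≢113^β eq with even-or-odd α
... | odd k  = twice-square≢3^[1+2k]+113^β y k β eq
... | even k = no-solution-3^k k β y 3^α≢113^β (trans (cong (_+ 113 ^ β) (sym (^-double 3 k))) (sym eq))

twice-square≢1+3^α*113^β : ∀ α β y → 1 < 3 ^ α * 113 ^ β → 2 * (y * y) ≢ 1 + 3 ^ α * 113 ^ β
twice-square≢1+3^α*113^β (suc α) β y _   = twice-square≢1+3^[1+α]*t y α (113 ^ β)
twice-square≢1+3^α*113^β zero    β y 1<N eq =
  reduced-equation 0 β y (<⇒≢ (subst (1 <_) (*-identityˡ (113 ^ β)) 1<N))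
    (trans eq (cong (λ t → 1 + t) (*-identityˡ (113 ^ β))))

proposition3p2 : (x y α β : ℕ) → x ≥ 1 → y ≥ 1 → gcd x y ≡ 1 →
  ¬ (x ^ 2 + 3 ^ α * 113 ^ β ≡ y ^ 4)
proposition3p2 x y α β x≥1 _ gcd≡1 eq =
  [ (λ (2y²≡1+N , 1<N) → twice-square≢1+3^α*113^β α β y 1<N 2y²≡1+N)
  , (λ (2y²≡3^α+113^β , 3^α≢113^β) → reduced-equation α β y 3^α≢113^β 2y²≡3^α+113^β) ]′
  (twice-square-equation {x} {y} {α} {β} x≥1 gcd≡1 eq)
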